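{- There exists no primitive formally dual set of rank two in any finite abelian group.
   Context: For a finite abelian group $G$ and a group isomorphism $\Delta:G\to\widehat G$, $y\mapsto\chi_y$, subsets $S,T\subseteq G$ form a formally dual pair if for all $y\in G$: $|\chi_y(S)|^2=\frac{|S|^2}{|T|}\nu_T(y)$ and $|\chi_y(T)|^2=\frac{|T|^2}{|S|}\nu_S(y)$, where $\chi(A)=\sum_{a\in A}\chi(a)$ and $\nu_A(y)=|\{(a_1,a_2)\in A\times A\mid y=a_1a_2^{ -1}\}|$. A subset is primitive if it is not contained in a coset of a proper subgroup and is not a union of cosets of a nontrivial subgroup; $S$ is a primitive formally dual set if there exist such $\Delta$ and $T$ with both $S$ and $T$ primitive. $S$ is an even set if, in the group ring $\mathbb{Z}[G]$, $SS^{(-1)}=\sum_{i=1}^r\lambda_iH_i$ for some subgroups $H_i$ (identified with the sum of their elements) and nonzero integers $\lambda_i$, where $S^{(-1)}=\sum_{s\in S}s^{ -1}$; its rank is the smallest such $r$. -}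

module Defs where

open import Level using (Level; _⊔_)
open import Data.Nat as ℕ using (ℕ; zero; suc; _<_)
open import Data.Integer as ℤ using (ℤ)
open import Data.Bool using (Bool; true; false; if_then_else_)
open import Data.Fin as Fin using (Fin; _≟_)
open import Data.Fin.Subset using (Subset; _∈_; _∉_; ∣_∣)
open import Data.Vec using (lookup)
open import Data.Product using (Σ; ∃; _×_; _,_)
open import Relation.Nullary using (¬_; does)
open import Relation.Binary.PropositionalEquality using (_≡_; _≢_)
open import Algebra.Bundles using (CommutativeRing)

record Field (c ℓ : Level) : Set (Level.suc (c ⊔ ℓ)) where
  field
    commRing : CommutativeRing c ℓ
  open CommutativeRing commRing public
  field
    1≉0     : ¬ (1# ≈ 0#)
    inverse : ∀ x → ¬ (x ≈ 0#) → Σ Carrier λ y → (x * y) ≈ 1#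

module _ {c ℓ} (F : Field c ℓ) where
  open Field F using (Carrier; 0#; 1#; _+_)

  natF : ℕ → Carrier
  natF zero    = 0#
  natF (suc m) = 1# + natF m

  ΣF : ∀ {n} → (Fin n → Carrier) → Carrier
  ΣF {zero}  f = 0#
  ΣF {suc n} f = f Fin.zero + ΣF (λ i → f (Fin.suc i))

CharZero : ∀ {c ℓ} → Field c ℓ → Set ℓ
CharZero F = ∀ m → ¬ (natF F (suc m) ≈ 0#)
  where open Field F using (_≈_; 0#)

Σℕ : ∀ {n} → (Fin n → ℕ) → ℕ
Σℕ {zero}  f = 0
Σℕ {suc n} f = f Fin.zero ℕ.+ Σℕ (λ i → f (Fin.suc i))

Σℤ : ∀ {n} → (Fin n → ℤ) → ℤ
Σℤ {zero}  f = ℤ.+ 0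
Σℤ {suc n} f = f Fin.zero ℤ.+ Σℤ (λ i → f (Fin.suc i))

-- Finite abelian groups, with carrier Fin order (every finite abelian
-- group is isomorphic to one of these, and all notions below are
-- invariant under isomorphism).

record FinAbGroup : Set where
  field
    order    : ℕ
    _∙_      : Fin order → Fin order → Fin order
    e        : Fin order
    inv      : Fin order → Fin order
    assoc    : ∀ a b c → ((a ∙ b) ∙ c) ≡ (a ∙ (b ∙ c))
    comm     : ∀ a b → (a ∙ b) ≡ (b ∙ a)
    identity : ∀ a → (e ∙ a) ≡ a
    inverse  : ∀ a → (inv a ∙ a) ≡ e

module _ (G : FinAbGroup) where
  open FinAbGroup G

  Elt : Set
  Elt = Fin order

  mem : Subset order → Elt → Bool
  mem A x = lookup A x

  ν : Subset order → Elt → ℕ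
  ν A y = Σℕ λ a₁ → Σℕ λ a₂ →
    if mem A a₁ then (if mem A a₂ then (if does (y ≟ (a₁ ∙ inv a₂)) then 1 else 0) else 0) else 0

  IsSubgroup : Subset order → Set
  IsSubgroup H = (e ∈ H) × (∀ a b → a ∈ H → b ∈ H → (a ∙ b) ∈ H) × (∀ a → a ∈ H → inv a ∈ H)

  Proper : Subset order → Set
  Proper H = ∃ λ g → g ∉ H

  Nontrivial : Subset order → Set
  Nontrivial H = ∃ λ h → (h ∈ H) × (h ≢ e)

  InCoset : Subset order → Subset order → Set
  InCoset A H = ∃ λ g → ∀ a → a ∈ A → (inv g ∙ a) ∈ H

  UnionOfCosets : Subset order → Subset order → Set
  UnionOfCosets A H = ∀ a h → a ∈ A → h ∈ H → (a ∙ h) ∈ A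

  Primitive : Subset order → Set
  Primitive A =
    ¬ (Σ (Subset order) λ H → IsSubgroup H × Proper H × InCoset A H) ×
    ¬ (Σ (Subset order) λ H → IsSubgroup H × Nontrivial H × UnionOfCosets A H)

  -- Even sets and rank:  S S^(-1) = Σ_{i<r} λ_i H_i  in ℤ[G].
  -- The coefficient of g in S S^(-1) is ν_S(g).

  EvenRepr : Subset order → ℕ → Set
  EvenRepr S r =
    Σ (Fin r → Subset order) λ H → Σ (Fin r → ℤ) λ lam →
      (∀ i → IsSubgroup (H i)) × (∀ i → lam i ≢ ℤ.+ 0) ×
      (∀ g → ℤ.+ (ν S g) ≡ Σℤ (λ i → if mem (H i) g then lam i else ℤ.+ 0))

  EvenOfRank : Subset order → ℕ → Set
  EvenOfRank S r = EvenRepr S r × (∀ r′ → r′ < r → ¬ EvenRepr S r′)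

  module _ {c ℓ} (F : Field c ℓ) where
    open Field F using (Carrier; _≈_; _*_; 0#; 1#)

    record Character : Set (c ⊔ ℓ) where
      field
        χ    : Elt → Carrier
        hom  : ∀ a b → χ (a ∙ b) ≈ (χ a * χ b)
        unit : χ e ≈ 1#
    open Character

    record DualIso : Set (c ⊔ ℓ) where
      field
        chr        : Elt → Character
        hom        : ∀ y z g → χ (chr (y ∙ z)) g ≈ (χ (chr y) g * χ (chr z) g)
        injective  : ∀ y z → (∀ g → χ (chr y) g ≈ χ (chr z) g) → y ≡ z
        surjective : ∀ (ψ : Character) → ∃ λ y → ∀ g → χ (chr y) g ≈ χ ψ g

    charSum : Character → Subset order → Carrier
    charSum ψ A = ΣF F λ a → if mem A a then χ ψ a else 0#

    -- χ(A^(-1)) = Σ_{a∈A} χ(a⁻¹) = complex conjugate of χ(A)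
    charSumInv : Character → Subset order → Carrier
    charSumInv ψ A = ΣF F λ a → if mem A a then χ ψ (inv a) else 0#

    -- |χ(A)|² = χ(A) · conj(χ(A)) = χ(A) χ(A^(-1))
    absSq : Character → Subset order → Carrier
    absSq ψ A = charSum ψ A * charSumInv ψ A

    -- formal duality, with denominators cleared:
    --   |T| · |χ_y(S)|² = |S|² ν_T(y),  |S| · |χ_y(T)|² = |T|² ν_S(y)
    FormallyDual : DualIso → Subset order → Subset order → Set ℓ
    FormallyDual Δ S T =
      (0 < ∣ S ∣) × (0 < ∣ T ∣) ×
      (∀ y → (natF F ∣ T ∣ * absSq (DualIso.chr Δ y) S) ≈ natF F (∣ S ∣ ℕ.* ∣ S ∣ ℕ.* ν T y)) ×
      (∀ y → (natF F ∣ S ∣ * absSq (DualIso.chr Δ y) T) ≈ natF F (∣ T ∣ ℕ.* ∣ T ∣ ℕ.* ν S y))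

    PrimitiveFormallyDualSet : Subset order → Set (c ⊔ ℓ)
    PrimitiveFormallyDualSet S =
      Σ DualIso λ Δ → Σ (Subset order) λ T →
        Primitive S × Primitive T × FormallyDual Δ S T

-- Write SS⁻¹ = λ₀H₀ + λ₁H₁. Every difference of S lies in H₀ ∪ H₁, which forces a
-- translate of S into one of the two subgroups; primitivity makes that subgroup all of G,
-- so ν_S is constant on the other subgroup H and constant off it, and minimality of the
-- rank makes H proper. Then |χ_y(S)|² = 0 whenever χ_y is nontrivial on H, so by duality
-- the differences of T lie in the annihilator of H, and primitivity of T makes every
-- character trivial on H. Hence ν_T, and then dually ν_S, are constant on G ∖ {e}.
-- Comparing the dual equations at the trivial and at a nontrivial character yields
-- |G| = |S||T| and shows that the smaller of S and T has no nontrivial differences,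
-- i.e. is a single point, which contradicts its primitivity.

module Submission where

open import Defs
open import Function using (_∘_)
open import Data.Bool using (Bool; true; false; not; if_then_else_)
open import Data.Nat as ℕ using (ℕ; zero; suc; _≤_; _<_; z≤n; s≤s)
import Data.Nat.Properties as ℕ
open import Data.Fin as Fin using (Fin; _≟_; punchIn)
import Data.Fin.Properties as Fin
open import Data.Fin.Subset using (Subset; _∈_; _∉_; ∣_∣; ⁅_⁆; ∁)
open import Data.Product using (∃; _×_; _,_; proj₁; proj₂)
open import Data.Sum using (_⊎_; inj₁; inj₂; [_,_])
open import Data.Empty using (⊥; ⊥-elim)
open import Relation.Nullary using (¬_; ¬?; Dec; yes; no; does; contradiction; _×-dec_; _→-dec_)
open import Relation.Nullary.Decidable using (dec-true; decidable-stable; ¬¬-excluded-middle)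
open import Data.Fin.Patterns using (0F; 1F)
import Data.Integer as ℤ
import Data.Integer.Properties as ℤ
open import Relation.Binary.PropositionalEquality as ≡ using (_≡_; _≢_)
open import Algebra.Bundles using (CommutativeMonoid)
open import Data.Vec using (lookup; tabulate; _∷_; []; here; there)
import Data.Vec.Properties as Vec
open import Data.Fin.Subset.Properties using (_∈?_; nonempty?; Empty-unique; ∣⊥∣≡0; x∈⁅x⁆; x∈⁅y⁆⇒x≡y; x∉⁅y⁆⇒x≢y; x≢y⇒x∉⁅y⁆; ∣⁅x⁆∣≡1; x∉p⇒x∈∁p; p⊆q⇒∣p∣≤∣q∣)

Σℕ-≥ : ∀ {n} (f : Fin n → ℕ) i → f i ≤ Σℕ f
Σℕ-≥ f Fin.zero    = ℕ.m≤m+n _ _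
Σℕ-≥ f (Fin.suc i) = ℕ.≤-trans (Σℕ-≥ (f ∘ Fin.suc) i) (ℕ.m≤n+m _ (f Fin.zero))

0<∣p∣⇒Nonempty : ∀ {n} (p : Subset n) → 0 < ∣ p ∣ → ∃ (_∈ p)
0<∣p∣⇒Nonempty {n} p 0<∣p∣ with nonempty? p
... | yes ne = ne
... | no ¬ne = contradiction (≡.trans (≡.cong ∣_∣ (Empty-unique ¬ne)) (∣⊥∣≡0 n)) (ℕ.>⇒≢ 0<∣p∣)

module _ {n p} {P : Fin n → Set p} (P? : ∀ x → Dec (P x)) where

  fromDec : Subset n
  fromDec = tabulate (does ∘ P?)

  ∈-fromDec⁺ : ∀ {x} → P x → x ∈ fromDec
  ∈-fromDec⁺ {x} px = Vec.lookup⇒[]= x fromDec (≡.trans (Vec.lookup∘tabulate (does ∘ P?) x) (dec-true (P? x) px))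

  ∈-fromDec⁻ : ∀ {x} → x ∈ fromDec → P x
  ∈-fromDec⁻ {x} x∈ with P? x | ≡.trans (≡.sym (Vec.lookup∘tabulate (does ∘ P?) x)) (Vec.[]=⇒lookup x∈)
  ... | yes px | _  = px
  ... | no  _  | ()

¬¬-∀-Fin : ∀ {p} n {P : Fin n → Set p} → (∀ i → ¬ ¬ P i) → ¬ ¬ (∀ i → P i)
¬¬-∀-Fin zero    _    k = k (λ ())
¬¬-∀-Fin (suc n) ¬¬P k = ¬¬P Fin.zero λ p₀ → ¬¬-∀-Fin n (¬¬P ∘ Fin.suc) λ ps →
  k λ { Fin.zero → p₀ ; (Fin.suc i) → ps i }

module _ {c ℓ} (M : CommutativeMonoid c ℓ) where
  open CommutativeMonoid M renaming (_∙_ to _+_; ε to 0#)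
  open import Algebra.Properties.CommutativeMonoid.Sum M
  open import Relation.Binary.Reasoning.Setoid setoid

  sum-if-unique : ∀ {n} (p : Fin n → Bool) (f : Fin n → Carrier) {j} → p j ≡ true →
                  (∀ {i} → p i ≡ true → i ≡ j) → sum (λ i → if p i then f i else 0#) ≈ f j
  sum-if-unique {suc n} p f {j} pj unique = begin
    sum t                        ≈⟨ sum-remove t ⟩
    t j + sum (t ∘ punchIn j)    ≈⟨ ∙-cong (reflexive (≡.cong (if_then f j else 0#) pj)) restVanishes ⟩
    f j + 0#                     ≈⟨ identityʳ (f j) ⟩
    f j                          ∎
    where
    t = λ i → if p i then f i else 0#
    restVanishes : sum (t ∘ punchIn j) ≈ 0#
    restVanishes = trans (sum-cong-≋ vanish) (sum-replicate-zero n)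
      where
      vanish : ∀ i → t (punchIn j i) ≈ 0#
      vanish i with p (punchIn j i) in eq
      ... | true  = contradiction (unique eq) (Fin.punchInᵢ≢i j i)
      ... | false = refl

module FieldProperties {c ℓ} (F : Field c ℓ) where
  open Field F renaming (inverse to reciprocal)
  open import Algebra.Properties.Semiring.Sum semiring public
    using (sum; sum-cong-≋; sum-replicate-zero; sum-permute; ∑-distrib-+; ∑-comm; *-distribˡ-sum; *-distribʳ-sum)
  open import Algebra.Properties.Semiring.Mult semiring using (×-homo-+; ×1-homo-*) renaming (_×_ to _·1_)
  import Algebra.Properties.Group +-group as AdditiveGroup
  open import Algebra.Properties.Ring ring using (-1*x≈-x)
  open import Relation.Binary.Reasoning.Setoid setoid

  ΣF≡sum : ∀ {n} (f : Fin n → Carrier) → ΣF F f ≡ sum f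
  ΣF≡sum {zero}  f = ≡.refl
  ΣF≡sum {suc n} f = ≡.cong (f Fin.zero +_) (ΣF≡sum (f ∘ Fin.suc))

  natF≡·1 : ∀ m → natF F m ≡ m ·1 1#
  natF≡·1 zero    = ≡.refl
  natF≡·1 (suc m) = ≡.cong (1# +_) (natF≡·1 m)

  natF-+ : ∀ a b → natF F (a ℕ.+ b) ≈ natF F a + natF F b
  natF-+ a b rewrite natF≡·1 a | natF≡·1 b | natF≡·1 (a ℕ.+ b) = ×-homo-+ 1# a b

  natF-* : ∀ a b → natF F (a ℕ.* b) ≈ natF F a * natF F b
  natF-* a b rewrite natF≡·1 a | natF≡·1 b | natF≡·1 (a ℕ.* b) = ×1-homo-* a b

  natF-Σℕ : ∀ {n} (f : Fin n → ℕ) → natF F (Σℕ f) ≈ sum (natF F ∘ f)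
  natF-Σℕ {zero}  f = refl
  natF-Σℕ {suc n} f = trans (natF-+ (f Fin.zero) (Σℕ (f ∘ Fin.suc))) (+-congˡ (natF-Σℕ (f ∘ Fin.suc)))

  natF-injective : CharZero F → ∀ {a b} → natF F a ≈ natF F b → a ≡ b
  natF-injective cz {zero}  {zero}  _ = ≡.refl
  natF-injective cz {zero}  {suc b} h = contradiction (sym h) (cz b)
  natF-injective cz {suc a} {zero}  h = contradiction h (cz a)
  natF-injective cz {suc a} {suc b} h = ≡.cong suc (natF-injective cz (AdditiveGroup.∙-cancelˡ 1# _ _ h))

  sum-zero : ∀ {n} {f : Fin n → Carrier} → (∀ i → f i ≈ 0#) → sum f ≈ 0#
  sum-zero {n} f≈0 = trans (sum-cong-≋ f≈0) (sum-replicate-zero n)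

  ΣF-count : ∀ {n} (A : Subset n) (f : Fin n → Carrier) → (∀ i → i ∈ A → f i ≈ 1#) →
             ΣF F (λ i → if lookup A i then f i else 0#) ≈ natF F ∣ A ∣
  ΣF-count []           f f≈1 = refl
  ΣF-count (true  ∷ A) f f≈1 =
    +-cong (f≈1 Fin.zero here) (ΣF-count A (f ∘ Fin.suc) (λ i i∈A → f≈1 (Fin.suc i) (there i∈A)))
  ΣF-count (false ∷ A) f f≈1 =
    trans (+-identityˡ _) (ΣF-count A (f ∘ Fin.suc) (λ i i∈A → f≈1 (Fin.suc i) (there i∈A)))

  [αx+βy]+βx≈αx : ∀ α β {x y} → x + y ≈ 0# → (α * x + β * y) + β * x ≈ α * x
  [αx+βy]+βx≈αx α β {x} {y} x+y≈0 = begin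
    (α * x + β * y) + β * x    ≈⟨ +-assoc _ _ _ ⟩
    α * x + (β * y + β * x)    ≈⟨ +-congˡ (distribˡ β y x) ⟨
    α * x + β * (y + x)        ≈⟨ +-congˡ (*-congˡ (trans (+-comm y x) x+y≈0)) ⟩
    α * x + β * 0#             ≈⟨ +-congˡ (zeroʳ β) ⟩
    α * x + 0#                 ≈⟨ +-identityʳ _ ⟩
    α * x                      ∎

  x*y≈0⇒y≈0 : ∀ {x y} → x * y ≈ 0# → ¬ (x ≈ 0#) → y ≈ 0#
  x*y≈0⇒y≈0 {x} {y} xy≈0 x≉0 = begin
    y              ≈⟨ sym (*-identityˡ y) ⟩
    1# * y         ≈⟨ *-congʳ (sym (trans (*-comm x′ x) xx′≈1)) ⟩
    (x′ * x) * y   ≈⟨ *-assoc x′ x y ⟩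
    x′ * (x * y)   ≈⟨ *-congˡ xy≈0 ⟩
    x′ * 0#        ≈⟨ zeroʳ x′ ⟩
    0#             ∎
    where
    x′ = proj₁ (reciprocal x x≉0)
    xx′≈1 = proj₂ (reciprocal x x≉0)

  x*a≈a⇒a≈0 : ∀ {x a} → x * a ≈ a → ¬ (x ≈ 1#) → a ≈ 0#
  x*a≈a⇒a≈0 {x} {a} fixed x≉1 = x*y≈0⇒y≈0 (begin
    (x - 1#) * a         ≈⟨ distribʳ a x (- 1#) ⟩
    x * a + - 1# * a     ≈⟨ +-congˡ (-1*x≈-x a) ⟩
    x * a - a            ≈⟨ AdditiveGroup.x≈y⇒x∙y⁻¹≈ε fixed ⟩
    0#                   ∎) (x≉1 ∘ AdditiveGroup.x∙y⁻¹≈ε⇒x≈y x 1#)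

  x*x≈x⇒x≈1 : ∀ {x} → x * x ≈ x → ¬ (x ≈ 0#) → x ≈ 1#
  x*x≈x⇒x≈1 {x} idem x≉0 = begin
    x              ≈⟨ sym (*-identityʳ x) ⟩
    x * 1#         ≈⟨ *-congˡ (sym xx′≈1) ⟩
    x * (x * x′)   ≈⟨ sym (*-assoc x x x′) ⟩
    (x * x) * x′   ≈⟨ *-congʳ idem ⟩
    x * x′         ≈⟨ xx′≈1 ⟩
    1#             ∎
    where
    x′ = proj₁ (reciprocal x x≉0)
    xx′≈1 = proj₂ (reciprocal x x≉0)

module Arithmetic where
  open import Data.Nat using (_+_; _*_)

  square-cancelˡ : ∀ s {x y} → 0 < s → s * s * x ≡ s * s * y → x ≡ y
  square-cancelˡ (suc s) {x} {y} _ = ℕ.*-cancelˡ-≡ x y (suc s * suc s)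

  -- With w + 1 = |G| this is |G| = |S||T|.
  formallyDual-order : ∀ {s t w m μ} → 0 < s → 0 < t → s + m * w ≡ s * s → t + μ * w ≡ t * t →
                       t * s ≡ s * s * μ + t * m → w + 1 ≡ t * s
  formallyDual-order {s@(suc _)} {t@(suc _)} {w} {m} {μ} _ _ Es Et Est =
    ℕ.*-cancelˡ-≡ (w + 1) (t * s) (t * s) (ℕ.+-cancelʳ-≡ (s * s * t) _ _ (begin
      t * s * (w + 1) + s * s * t             ≡⟨ solve 3 (λ s t w → t :* s :* (w :+ con 1) :+ s :* s :* t := t :* s :* w :+ t :* s :+ s :* s :* t) ≡.refl s t w ⟩
      t * s * w + t * s + s * s * t           ≡⟨ ≡.cong (λ z → z * w + t * s + s * s * t) Est ⟩
      (s * s * μ + t * m) * w + t * s + s * s * t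
        ≡⟨ solve 5 (λ s t w m μ → (s :* s :* μ :+ t :* m) :* w :+ t :* s :+ s :* s :* t := s :* s :* (t :+ μ :* w) :+ t :* (s :+ m :* w)) ≡.refl s t w m μ ⟩
      s * s * (t + μ * w) + t * (s + m * w)   ≡⟨ ≡.cong₂ (λ a b → s * s * a + t * b) Et Es ⟩
      s * s * (t * t) + t * (s * s)           ≡⟨ solve 2 (λ s t → s :* s :* (t :* t) :+ t :* (s :* s) := t :* s :* (t :* s) :+ s :* s :* t) ≡.refl s t ⟩
      t * s * (t * s) + s * s * t             ∎))
    where
    open ≡.≡-Reasoning
    open import Data.Nat.Solver using (module +-*-Solver)
    open +-*-Solver

  -- For m > 0: s + w ≤ s + m·w = s² ≤ t·s = w + 1 forces s = 1, and then m·w = 0.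
  smaller-level≡0 : ∀ {s t w m} → 0 < s → s ≤ t → 0 < w → s + m * w ≡ s * s → w + 1 ≡ t * s → m ≡ 0
  smaller-level≡0 {m = zero}  _   _   _   _  _ = ≡.refl
  smaller-level≡0 {s} {t} {w} {suc m} 0<s s≤t 0<w Es W = contradiction (≡.sym Es) (ℕ.<⇒≢ s*s<s+m*w)
    where
    w≤m*w : w ≤ suc m * w
    w≤m*w = ℕ.m≤n*m w (suc m)
    s≤1 : s ≤ 1
    s≤1 = ℕ.+-cancelʳ-≤ w s 1 (begin
      s + w              ≤⟨ ℕ.+-monoʳ-≤ s w≤m*w ⟩
      s + suc m * w      ≡⟨ Es ⟩
      s * s              ≤⟨ ℕ.*-monoˡ-≤ s s≤t ⟩
      t * s              ≡⟨ ≡.sym W ⟩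
      w + 1              ≡⟨ ℕ.+-comm w 1 ⟩
      1 + w              ∎)
      where open ℕ.≤-Reasoning
    s*s<s+m*w : s * s < s + suc m * w
    s*s<s+m*w rewrite ℕ.≤-antisym s≤1 0<s = s≤s (ℕ.≤-trans 0<w w≤m*w)

  one-level≡0 : ∀ {s t w m μ} → 0 < s → 0 < t → 0 < w → s + m * w ≡ s * s → t + μ * w ≡ t * t →
                t * s ≡ s * s * μ + t * m → m ≡ 0 ⊎ μ ≡ 0
  one-level≡0 {s} {t} 0<s 0<t 0<w Es Et Est with ℕ.≤-total s t
  ... | inj₁ s≤t = inj₁ (smaller-level≡0 0<s s≤t 0<w Es order)
    where order = formallyDual-order 0<s 0<t Es Et Est
  ... | inj₂ t≤s = inj₂ (smaller-level≡0 0<t t≤s 0<w Et (≡.trans order (ℕ.*-comm t s)))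
    where order = formallyDual-order 0<s 0<t Es Et Est

module FinAbGroupProperties (G : FinAbGroup) where
  open FinAbGroup G

  inverseʳ : ∀ a → a ∙ inv a ≡ e
  inverseʳ a = ≡.trans (comm a (inv a)) (inverse a)

  identityʳ : ∀ a → a ∙ e ≡ a
  identityʳ a = ≡.trans (comm a e) (identity a)

  x∙[x⁻¹∙y]≡y : ∀ x y → x ∙ (inv x ∙ y) ≡ y
  x∙[x⁻¹∙y]≡y x y = ≡.trans (≡.sym (assoc x (inv x) y)) (≡.trans (≡.cong (_∙ y) (inverseʳ x)) (identity y))

  x⁻¹∙[x∙y]≡y : ∀ x y → inv x ∙ (x ∙ y) ≡ y
  x⁻¹∙[x∙y]≡y x y = ≡.trans (≡.sym (assoc (inv x) x y)) (≡.trans (≡.cong (_∙ y) (inverse x)) (identity y))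

  [x∙y]∙y⁻¹≡x : ∀ x y → (x ∙ y) ∙ inv y ≡ x
  [x∙y]∙y⁻¹≡x x y = ≡.trans (assoc x y (inv y)) (≡.trans (≡.cong (x ∙_) (inverseʳ y)) (identityʳ x))

  [z∙x]∙[y∙x⁻¹]≡z∙y : ∀ x y z → (z ∙ x) ∙ (y ∙ inv x) ≡ z ∙ y
  [z∙x]∙[y∙x⁻¹]≡z∙y x y z = ≡.trans (assoc z x (y ∙ inv x))
    (≡.cong (z ∙_) (≡.trans (≡.cong (x ∙_) (comm y (inv x))) (x∙[x⁻¹∙y]≡y x y)))

  inv-e : inv e ≡ e
  inv-e = ≡.trans (≡.sym (identityʳ (inv e))) (inverse e)

  ∈⇒mem : ∀ {A x} → x ∈ A → mem G A x ≡ true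
  ∈⇒mem = Vec.[]=⇒lookup

  mem⇒∈ : ∀ {A x} → mem G A x ≡ true → x ∈ A
  mem⇒∈ {A} {x} = Vec.lookup⇒[]= x A

  ∉⇒mem≡false : ∀ {A x} → x ∉ A → mem G A x ≡ false
  ∉⇒mem≡false {A} {x} x∉A with mem G A x in eq
  ... | true  = contradiction (mem⇒∈ eq) x∉A
  ... | false = ≡.refl

  mem-∁ : ∀ A x → mem G (∁ A) x ≡ not (mem G A x)
  mem-∁ A x = Vec.lookup-map x not A

  ν-positive : ∀ {A a₁ a₂} → a₁ ∈ A → a₂ ∈ A → 0 < ν G A (a₁ ∙ inv a₂)
  ν-positive {A} {a₁} {a₂} a₁∈A a₂∈A =
    ℕ.≤-trans pairCounted (ℕ.≤-trans (Σℕ-≥ _ a₂) (Σℕ-≥ _ a₁))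
    where
    y = a₁ ∙ inv a₂
    pairCounted : 1 ≤ (if mem G A a₁ then (if mem G A a₂ then (if does (y ≟ y) then 1 else 0) else 0) else 0)
    pairCounted rewrite ∈⇒mem a₁∈A | ∈⇒mem a₂∈A | dec-true (y ≟ y) ≡.refl = s≤s z≤n

  module Subgroup {H} (H≤G : IsSubgroup G H) where
    e∈H : e ∈ H
    e∈H = proj₁ H≤G

    ∙-closed : ∀ {a b} → a ∈ H → b ∈ H → a ∙ b ∈ H
    ∙-closed = proj₁ (proj₂ H≤G) _ _

    inv-closed : ∀ {a} → a ∈ H → inv a ∈ H
    inv-closed = proj₂ (proj₂ H≤G) _

    mem-translation-invariant : ∀ {h} → h ∈ H → ∀ g → mem G H (h ∙ g) ≡ mem G H g
    mem-translation-invariant {h} h∈H g with g ∈? H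
    ... | yes g∈H = ≡.trans (∈⇒mem (∙-closed h∈H g∈H)) (≡.sym (∈⇒mem g∈H))
    ... | no  g∉H = ≡.trans (∉⇒mem≡false hg∉H) (≡.sym (∉⇒mem≡false g∉H))
      where
      hg∉H : h ∙ g ∉ H
      hg∉H hg∈H = g∉H (≡.subst (_∈ H) (x⁻¹∙[x∙y]≡y h g) (∙-closed (inv-closed h∈H) hg∈H))

  ⁅e⁆-isSubgroup : IsSubgroup G ⁅ e ⁆
  ⁅e⁆-isSubgroup = x∈⁅x⁆ e , ∙-closed , inv-closed
    where
    ∙-closed : ∀ a b → a ∈ ⁅ e ⁆ → b ∈ ⁅ e ⁆ → a ∙ b ∈ ⁅ e ⁆
    ∙-closed a b a∈ b∈ rewrite x∈⁅y⁆⇒x≡y e a∈ | x∈⁅y⁆⇒x≡y e b∈ | identity e = x∈⁅x⁆ e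
    inv-closed : ∀ a → a ∈ ⁅ e ⁆ → inv a ∈ ⁅ e ⁆
    inv-closed a a∈ rewrite x∈⁅y⁆⇒x≡y e a∈ | inv-e = x∈⁅x⁆ e

  InCoset⇒total : ∀ {A H} → Primitive G A → IsSubgroup G H → InCoset G A H → ∀ g → g ∈ H
  InCoset⇒total {A} {H} prim H≤G A⊆aH g with g ∈? H
  ... | yes g∈H = g∈H
  ... | no  g∉H = contradiction (H , H≤G , (g , g∉H) , A⊆aH) (proj₁ prim)

  ν-support⇒InCoset : ∀ {A H a} → a ∈ A → (∀ y → 0 < ν G A y → y ∈ H) → InCoset G A H
  ν-support⇒InCoset {A} {H} {a} a∈A support =
    a , λ x x∈A → ≡.subst (_∈ H) (comm x (inv a)) (support _ (ν-positive x∈A a∈A))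

  -- In ℤ[G] this says AA⁻¹ = (a − b)·H + b·G.
  record TwoValued (A H : Subset order) (a b : ℕ) : Set where
    field
      inside  : ∀ {g} → g ∈ H → ν G A g ≡ a
      outside : ∀ {g} → g ∉ H → ν G A g ≡ b

  vanishing-off⇒total : ∀ {A H a x} → Primitive G A → IsSubgroup G H → TwoValued A H a 0 → x ∈ A →
                        ∀ g → g ∈ H
  vanishing-off⇒total {A} {H} prim H≤G levels x∈A = InCoset⇒total prim H≤G (ν-support⇒InCoset x∈A support)
    where
    support : ∀ y → 0 < ν G A y → y ∈ H
    support y 0<ν with y ∈? H
    ... | yes y∈H = y∈H
    ... | no  y∉H = contradiction (TwoValued.outside levels y∉H) (ℕ.>⇒≢ 0<ν)

  primitive⇒level≢0 : ∀ {A a b g} → Primitive G A → 0 < ∣ A ∣ → g ≢ e → TwoValued A ⁅ e ⁆ a b → b ≢ 0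
  primitive⇒level≢0 {A} {a} prim 0<∣A∣ g≢e levels ≡.refl =
    g≢e (x∈⁅y⁆⇒x≡y e (vanishing-off⇒total prim ⁅e⁆-isSubgroup levels (proj₂ (0<∣p∣⇒Nonempty A 0<∣A∣)) _))

  constantOff-e⇒TwoValued : ∀ {A a g₀} → ν G A e ≡ a → (∀ {y z} → y ≢ e → z ≢ e → ν G A y ≡ ν G A z) →
                            g₀ ≢ e → TwoValued A ⁅ e ⁆ a (ν G A g₀)
  constantOff-e⇒TwoValued {A} νe≡a constant g₀≢e = record
    { inside  = λ g∈⁅e⁆ → ≡.trans (≡.cong (ν G A) (x∈⁅y⁆⇒x≡y e g∈⁅e⁆)) νe≡a
    ; outside = λ g∉⁅e⁆ → constant (x∉⁅y⁆⇒x≢y g∉⁅e⁆) g₀≢e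
    }

  -- If a⁻¹x ∉ H₀ and a⁻¹y ∉ H₁, the difference yx⁻¹ can lie in neither subgroup.
  translate-in-one-of : ∀ {A H₀ H₁ a} → IsSubgroup G H₀ → IsSubgroup G H₁ →
    (∀ {x y} → x ∈ A → y ∈ A → (x ∙ inv y ∈ H₀) ⊎ (x ∙ inv y ∈ H₁)) → a ∈ A →
    (∀ {x} → x ∈ A → inv a ∙ x ∈ H₀) ⊎ (∀ {x} → x ∈ A → inv a ∙ x ∈ H₁)
  translate-in-one-of {A} {H₀} {H₁} {a} H₀≤G H₁≤G diff a∈A
    with Fin.any? (λ x → x ∈? A ×-dec ¬? (inv a ∙ x ∈? H₀))
  ... | no ¬escape = inj₁ inH₀
    where
    inH₀ : ∀ {x} → x ∈ A → inv a ∙ x ∈ H₀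
    inH₀ {x} x∈A with inv a ∙ x ∈? H₀
    ... | yes u∈H₀ = u∈H₀
    ... | no  u∉H₀ = contradiction (x , x∈A , u∉H₀) ¬escape
  ... | yes (x , x∈A , u∉H₀) = inj₂ inH₁
    where
    module H₀ = Subgroup H₀≤G
    module H₁ = Subgroup H₁≤G
    translate : ∀ {y} → y ∈ A → (inv a ∙ y ∈ H₀) ⊎ (inv a ∙ y ∈ H₁)
    translate {y} y∈A rewrite comm (inv a) y = diff y∈A a∈A
    u∈H₁ : inv a ∙ x ∈ H₁
    u∈H₁ with translate x∈A
    ... | inj₁ u∈H₀ = contradiction u∈H₀ u∉H₀
    ... | inj₂ u∈H₁ = u∈H₁
    inH₁ : ∀ {y} → y ∈ A → inv a ∙ y ∈ H₁
    inH₁ {y} y∈A with inv a ∙ y ∈? H₁ | translate y∈A | diff y∈A x∈A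
    ... | yes v∈H₁ | _          | _          = v∈H₁
    ... | no  v∉H₁ | inj₂ v∈H₁  | _          = contradiction v∈H₁ v∉H₁
    ... | no  v∉H₁ | inj₁ _     | inj₂ d∈H₁  =
      contradiction (≡.subst (_∈ H₁) ([z∙x]∙[y∙x⁻¹]≡z∙y x y (inv a)) (H₁.∙-closed u∈H₁ d∈H₁)) v∉H₁
    ... | no  v∉H₁ | inj₁ v∈H₀  | inj₁ d∈H₀  =
      contradiction (≡.subst (_∈ H₀) v∙d⁻¹≡u (H₀.∙-closed v∈H₀ (H₀.inv-closed d∈H₀))) u∉H₀
      where
      v∙d⁻¹≡u : (inv a ∙ y) ∙ inv (y ∙ inv x) ≡ inv a ∙ x
      v∙d⁻¹≡u = ≡.trans (≡.cong (_∙ inv (y ∙ inv x)) (≡.sym ([z∙x]∙[y∙x⁻¹]≡z∙y x y (inv a))))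
                        ([x∙y]∙y⁻¹≡x (inv a ∙ x) (y ∙ inv x))

module EvenRankTwo (G : FinAbGroup) where
  open import Data.Integer using (ℤ; +_)
  open FinAbGroup G
  open FinAbGroupProperties G

  record ProperTwoValued (A : Subset order) : Set where
    field
      H         : Subset order
      H≤G       : IsSubgroup G H
      g₀        : Elt G
      g₀∉H      : g₀ ∉ H
      a b       : ℕ
      twoValued : TwoValued A H a b

  weight : Subset order → ℤ → Elt G → ℤ
  weight H l g = if mem G H g then l else + 0

  weight-∈ : ∀ {H l g} → g ∈ H → weight H l g ≡ l
  weight-∈ g∈H rewrite ∈⇒mem g∈H = ≡.refl

  weight-∉ : ∀ {H l g} → g ∉ H → weight H l g ≡ + 0
  weight-∉ g∉H rewrite ∉⇒mem≡false g∉H = ≡.refl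

  ¬rankOne : ∀ {S H l} → EvenOfRank G S 2 → IsSubgroup G H → l ≢ + 0 →
             (∀ g → + ν G S g ≡ weight H l g) → ⊥
  ¬rankOne {S} {H} {l} (_ , minimal) H≤G l≢0 eq =
    minimal 1 (s≤s (s≤s z≤n)) ((λ _ → H) , (λ _ → l) , (λ _ → H≤G) , (λ _ → l≢0) , eq′)
    where
    eq′ : ∀ g → + ν G S g ≡ weight H l g ℤ.+ + 0
    eq′ g = ≡.trans (eq g) (≡.sym (ℤ.+-identityʳ _))

  differences-in-union : ∀ {S H₀ H₁ l₀ l₁} →
    (∀ g → + ν G S g ≡ weight H₀ l₀ g ℤ.+ (weight H₁ l₁ g ℤ.+ + 0)) →
    ∀ {x y} → x ∈ S → y ∈ S → (x ∙ inv y ∈ H₀) ⊎ (x ∙ inv y ∈ H₁)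
  differences-in-union {H₀ = H₀} {H₁} {l₀} {l₁} eq {x} {y} x∈S y∈S
    with x ∙ inv y ∈? H₀ | x ∙ inv y ∈? H₁
  ... | yes d∈H₀ | _        = inj₁ d∈H₀
  ... | no  _    | yes d∈H₁ = inj₂ d∈H₁
  ... | no  d∉H₀ | no  d∉H₁ = contradiction (ℤ.+-injective ν≡0) (ℕ.>⇒≢ (ν-positive x∈S y∈S))
    where
    ν≡0 = ≡.trans (eq _) (≡.cong₂ (λ u v → u ℤ.+ (v ℤ.+ + 0)) (weight-∉ {l = l₀} d∉H₀) (weight-∉ {l = l₁} d∉H₁))

  properTwoValued : ∀ {S X x lx ly} → EvenOfRank G S 2 → x ∈ S → IsSubgroup G X →
    (∀ g → + ν G S g ≡ weight X lx g ℤ.+ ly) → ProperTwoValued S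
  properTwoValued {S} {X} {x} {lx} {ly} rank2 x∈S X≤G eq = byTotality (Fin.all? (_∈? X))
    where
    onX : ∀ {g} → g ∈ X → + ν G S g ≡ lx ℤ.+ ly
    onX g∈X = ≡.trans (eq _) (≡.cong (ℤ._+ ly) (weight-∈ g∈X))
    offX : ∀ {g} → g ∉ X → + ν G S g ≡ ly
    offX g∉X = ≡.trans (eq _) (≡.trans (≡.cong (ℤ._+ ly) (weight-∉ {l = lx} g∉X)) (ℤ.+-identityˡ ly))
    e∈X = Subgroup.e∈H X≤G

    byTotality : Dec (∀ g → g ∈ X) → ProperTwoValued S
    byTotality (yes total) =
      ⊥-elim (¬rankOne {S} rank2 X≤G lx+ly≢0 (λ g → ≡.trans (onX (total g)) (≡.sym (weight-∈ (total g)))))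
      where
      lx+ly≢0 : lx ℤ.+ ly ≢ + 0
      lx+ly≢0 sum≡0 = ℕ.>⇒≢ (ν-positive x∈S x∈S) (ℤ.+-injective (≡.trans (onX (total (x ∙ inv x))) sum≡0))
    byTotality (no ¬total) = record
      { H = X ; H≤G = X≤G ; g₀ = g₀ ; g₀∉H = g₀∉X
      ; a = ν G S e ; b = ν G S g₀
      ; twoValued = record
        { inside  = λ g∈X → ℤ.+-injective (≡.trans (onX g∈X) (≡.sym (onX e∈X)))
        ; outside = λ g∉X → ℤ.+-injective (≡.trans (offX g∉X) (≡.sym (offX g₀∉X)))
        }
      }
      where
      g₀ = proj₁ (Fin.¬∀⟶∃¬ _ _ (_∈? X) ¬total)
      g₀∉X = proj₂ (Fin.¬∀⟶∃¬ _ _ (_∈? X) ¬total)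

  rankTwo⇒ProperTwoValued : ∀ {S} → Primitive G S → 0 < ∣ S ∣ → EvenOfRank G S 2 → ProperTwoValued S
  rankTwo⇒ProperTwoValued {S} prim 0<∣S∣ rank2@((H , l , H≤G , _ , eq) , _)
    with 0<∣p∣⇒Nonempty S 0<∣S∣
  ... | a , a∈S with translate-in-one-of (H≤G 0F) (H≤G 1F) (differences-in-union eq) a∈S
  ... | inj₁ a⁻¹S⊆H₀ = properTwoValued rank2 a∈S (H≤G 1F) eq′
    where
    H₀-total = InCoset⇒total prim (H≤G 0F) (a , λ _ → a⁻¹S⊆H₀)
    eq′ : ∀ g → + ν G S g ≡ weight (H 1F) (l 1F) g ℤ.+ l 0F
    eq′ g = ≡.trans (eq g) (≡.trans
      (≡.cong₂ ℤ._+_ (weight-∈ (H₀-total g)) (ℤ.+-identityʳ w₁)) (ℤ.+-comm (l 0F) w₁))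
      where w₁ = weight (H 1F) (l 1F) g
  ... | inj₂ a⁻¹S⊆H₁ = properTwoValued rank2 a∈S (H≤G 0F) eq′
    where
    H₁-total = InCoset⇒total prim (H≤G 1F) (a , λ _ → a⁻¹S⊆H₁)
    eq′ : ∀ g → + ν G S g ≡ weight (H 0F) (l 0F) g ℤ.+ l 1F
    eq′ g = ≡.trans (eq g) (≡.cong (ℤ._+_ (weight (H 0F) (l 0F) g))
      (≡.trans (ℤ.+-identityʳ _) (weight-∈ (H₁-total g))))

module CharacterSums {c ℓ} (F : Field c ℓ) (G : FinAbGroup) where
  open Field F renaming (inverse to reciprocal)
  open FinAbGroup G
  open FinAbGroupProperties G
  open FieldProperties F
  open Character
  open import Data.Fin.Permutation using (permutation)
  open import Relation.Binary.Reasoning.Setoid setoid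

  χ-nonzero : ∀ (ψ : Character G F) a → ¬ (χ ψ a ≈ 0#)
  χ-nonzero ψ a χa≈0 = 1≉0 (begin
    1#                     ≈⟨ sym (unit ψ) ⟩
    χ ψ e                  ≈⟨ reflexive (≡.cong (χ ψ) (≡.sym (inverse a))) ⟩
    χ ψ (inv a ∙ a)        ≈⟨ hom ψ (inv a) a ⟩
    χ ψ (inv a) * χ ψ a    ≈⟨ *-congˡ χa≈0 ⟩
    χ ψ (inv a) * 0#       ≈⟨ zeroʳ _ ⟩
    0#                     ∎)

  sum-translation-invariant : ∀ (ψ : Character G F) (p : Elt G → Bool) {h} →
    (∀ g → p (h ∙ g) ≡ p g) → ¬ (χ ψ h ≈ 1#) → sum (λ g → if p g then χ ψ g else 0#) ≈ 0#
  sum-translation-invariant ψ p {h} invariant χh≉1 = x*a≈a⇒a≈0 χh*Σ≈Σ χh≉1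
    where
    f = λ g → if p g then χ ψ g else 0#
    translate : ∀ g → χ ψ h * f g ≈ f (h ∙ g)
    translate g rewrite invariant g with p g
    ... | true  = sym (hom ψ h g)
    ... | false = zeroʳ _
    χh*Σ≈Σ : χ ψ h * sum f ≈ sum f
    χh*Σ≈Σ = begin
      χ ψ h * sum f             ≈⟨ *-distribˡ-sum (χ ψ h) f ⟩
      sum (λ g → χ ψ h * f g)   ≈⟨ sum-cong-≋ translate ⟩
      sum (λ g → f (h ∙ g))     ≈⟨ sum-permute f (permutation (h ∙_) (inv h ∙_) (x∙[x⁻¹∙y]≡y h) (x⁻¹∙[x∙y]≡y h)) ⟨
      sum f                     ∎

  sum-χ≈0 : ∀ (ψ : Character G F) {h} → ¬ (χ ψ h ≈ 1#) → sum (χ ψ) ≈ 0#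
  sum-χ≈0 ψ = sum-translation-invariant ψ (λ _ → true) (λ _ → ≡.refl)

  charSum-subgroup≈0 : ∀ (ψ : Character G F) {H h} → IsSubgroup G H → h ∈ H → ¬ (χ ψ h ≈ 1#) →
                       charSum G F ψ H ≈ 0#
  charSum-subgroup≈0 ψ {H} H≤G h∈H χh≉1 = trans (reflexive (ΣF≡sum (λ g → if mem G H g then χ ψ g else 0#)))
    (sum-translation-invariant ψ (mem G H) (Subgroup.mem-translation-invariant H≤G h∈H) χh≉1)

  charSum+charSum-∁ : ∀ (ψ : Character G F) A → charSum G F ψ A + charSum G F ψ (∁ A) ≈ sum (χ ψ)
  charSum+charSum-∁ ψ A = begin
    charSum G F ψ A + charSum G F ψ (∁ A)  ≡⟨ ≡.cong₂ _+_ (ΣF≡sum inA) (ΣF≡sum inA∁) ⟩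
    sum inA + sum inA∁                       ≈⟨ ∑-distrib-+ inA inA∁ ⟨
    sum (λ g → inA g + inA∁ g)               ≈⟨ sum-cong-≋ split ⟩
    sum (χ ψ)                                ∎
    where
    inA  = λ g → if mem G A g then χ ψ g else 0#
    inA∁ = λ g → if mem G (∁ A) g then χ ψ g else 0#
    split : ∀ g → inA g + inA∁ g ≈ χ ψ g
    split g rewrite mem-∁ A g with mem G A g
    ... | true  = +-identityʳ _
    ... | false = +-identityˡ _

  charSum-trivialOn : ∀ (ψ : Character G F) A → (∀ g → g ∈ A → χ ψ g ≈ 1#) → charSum G F ψ A ≈ natF F ∣ A ∣
  charSum-trivialOn ψ A = ΣF-count A (χ ψ)

  absSq-trivial : ∀ (ψ : Character G F) A → (∀ g → χ ψ g ≈ 1#) → absSq G F ψ A ≈ natF F (∣ A ∣ ℕ.* ∣ A ∣)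
  absSq-trivial ψ A trivial = trans
    (*-cong (ΣF-count A (χ ψ) (λ g _ → trivial g)) (ΣF-count A (χ ψ ∘ inv) (λ g _ → trivial (inv g))))
    (sym (natF-* ∣ A ∣ ∣ A ∣))

  absSq≈∑ν : ∀ (ψ : Character G F) A → absSq G F ψ A ≈ sum (λ y → natF F (ν G A y) * χ ψ y)
  absSq≈∑ν ψ A = begin
    absSq G F ψ A                                          ≡⟨ ≡.cong₂ _*_ (ΣF≡sum I₁) (ΣF≡sum I₂) ⟩
    sum I₁ * sum I₂                                        ≈⟨ *-distribʳ-sum (sum I₂) I₁ ⟩
    sum (λ a₁ → I₁ a₁ * sum I₂)                            ≈⟨ sum-cong-≋ (λ a₁ → *-distribˡ-sum (I₁ a₁) I₂) ⟩
    sum (λ a₁ → sum (λ a₂ → I₁ a₁ * I₂ a₂))                ≈⟨ sum-cong-≋ (λ a₁ → sum-cong-≋ (pair a₁)) ⟩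
    sum (λ a₁ → sum (λ a₂ → sum (λ y → term y a₁ a₂)))     ≈⟨ sum-cong-≋ (λ a₁ → ∑-comm (λ a₂ y → term y a₁ a₂)) ⟩
    sum (λ a₁ → sum (λ y → sum (λ a₂ → term y a₁ a₂)))     ≈⟨ ∑-comm (λ a₁ y → sum (λ a₂ → term y a₁ a₂)) ⟩
    sum (λ y → sum (λ a₁ → sum (λ a₂ → term y a₁ a₂)))     ≈⟨ sum-cong-≋ collect ⟨
    sum (λ y → natF F (ν G A y) * χ ψ y)                   ∎
    where
    I₁ = λ a → if mem G A a then χ ψ a else 0#
    I₂ = λ a → if mem G A a then χ ψ (inv a) else 0#
    count : Elt G → Elt G → Elt G → ℕ
    count y a₁ a₂ = if mem G A a₁ then (if mem G A a₂ then (if does (y ≟ (a₁ ∙ inv a₂)) then 1 else 0) else 0) else 0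
    term = λ y a₁ a₂ → natF F (count y a₁ a₂) * χ ψ y

    pair : ∀ a₁ a₂ → I₁ a₁ * I₂ a₂ ≈ sum (λ y → term y a₁ a₂)
    pair a₁ a₂ with mem G A a₁ | mem G A a₂
    ... | false | _     = trans (zeroˡ _) (sym (sum-zero (λ y → zeroˡ (χ ψ y))))
    ... | true  | false = trans (zeroʳ _) (sym (sum-zero (λ y → zeroˡ (χ ψ y))))
    ... | true  | true  = begin
      χ ψ a₁ * χ ψ (inv a₂)                          ≈⟨ hom ψ a₁ (inv a₂) ⟨
      χ ψ d                                          ≈⟨ sum-if-unique +-commutativeMonoid (λ y → does (y ≟ d)) (χ ψ) (dec-true (d ≟ d) ≡.refl) unique ⟨
      sum (λ y → if does (y ≟ d) then χ ψ y else 0#) ≈⟨ sum-cong-≋ indicator ⟨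
      sum (λ y → natF F (if does (y ≟ d) then 1 else 0) * χ ψ y) ∎
      where
      d = a₁ ∙ inv a₂
      unique : ∀ {y} → does (y ≟ d) ≡ true → y ≡ d
      unique {y} eq with y ≟ d
      ... | yes y≡d = y≡d
      indicator : ∀ y → natF F (if does (y ≟ d) then 1 else 0) * χ ψ y ≈ (if does (y ≟ d) then χ ψ y else 0#)
      indicator y with does (y ≟ d)
      ... | true  = trans (*-congʳ (+-identityʳ 1#)) (*-identityˡ _)
      ... | false = zeroˡ _

    collect : ∀ y → natF F (ν G A y) * χ ψ y ≈ sum (λ a₁ → sum (λ a₂ → term y a₁ a₂))
    collect y = begin
      natF F (ν G A y) * χ ψ y                                    ≈⟨ *-congʳ (natF-Σℕ (λ a₁ → Σℕ (count y a₁))) ⟩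
      sum (λ a₁ → natF F (Σℕ (count y a₁))) * χ ψ y               ≈⟨ *-distribʳ-sum (χ ψ y) (λ a₁ → natF F (Σℕ (count y a₁))) ⟩
      sum (λ a₁ → natF F (Σℕ (count y a₁)) * χ ψ y)               ≈⟨ sum-cong-≋ (λ a₁ → *-congʳ (natF-Σℕ (count y a₁))) ⟩
      sum (λ a₁ → sum (λ a₂ → natF F (count y a₁ a₂)) * χ ψ y)    ≈⟨ sum-cong-≋ (λ a₁ → *-distribʳ-sum (χ ψ y) (λ a₂ → natF F (count y a₁ a₂))) ⟩
      sum (λ a₁ → sum (λ a₂ → term y a₁ a₂))                      ∎

  absSq-twoValued : ∀ (ψ : Character G F) {A H a b} → TwoValued A H a b →
    absSq G F ψ A ≈ natF F a * charSum G F ψ H + natF F b * charSum G F ψ (∁ H)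
  absSq-twoValued ψ {A} {H} {a} {b} levels = begin
    absSq G F ψ A                                             ≈⟨ absSq≈∑ν ψ A ⟩
    sum (λ g → natF F (ν G A g) * χ ψ g)                      ≈⟨ sum-cong-≋ split ⟩
    sum (λ g → natF F a * inH g + natF F b * inH∁ g)          ≈⟨ ∑-distrib-+ (λ g → natF F a * inH g) (λ g → natF F b * inH∁ g) ⟩
    sum (λ g → natF F a * inH g) + sum (λ g → natF F b * inH∁ g)
      ≈⟨ +-cong (*-distribˡ-sum (natF F a) inH) (*-distribˡ-sum (natF F b) inH∁) ⟨
    natF F a * sum inH + natF F b * sum inH∁                  ≡⟨ ≡.cong₂ (λ u v → natF F a * u + natF F b * v) (ΣF≡sum inH) (ΣF≡sum inH∁) ⟨
    natF F a * charSum G F ψ H + natF F b * charSum G F ψ (∁ H) ∎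
    where
    open TwoValued levels
    inH  = λ g → if mem G H g then χ ψ g else 0#
    inH∁ = λ g → if mem G (∁ H) g then χ ψ g else 0#
    split : ∀ g → natF F (ν G A g) * χ ψ g ≈ natF F a * inH g + natF F b * inH∁ g
    split g with g ∈? H
    ... | yes g∈H rewrite inside g∈H | mem-∁ H g | ∈⇒mem g∈H = sym (trans (+-congˡ (zeroʳ _)) (+-identityʳ _))
    ... | no  g∉H rewrite outside g∉H | mem-∁ H g | ∉⇒mem≡false g∉H = sym (trans (+-congʳ (zeroʳ _)) (+-identityˡ _))

module FormalDuality {c ℓ} (F : Field c ℓ) (charZero : CharZero F) (G : FinAbGroup) (Δ : DualIso G F) where
  open Field F renaming (inverse to reciprocal)
  open FinAbGroup G
  open FinAbGroupProperties G
  open FieldProperties F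
  open CharacterSums F G
  open Character
  open DualIso Δ renaming (hom to chr-hom)
  open EvenRankTwo G
  open Arithmetic
  open import Relation.Binary.Reasoning.Setoid setoid

  DualEquation : Subset order → Subset order → Set ℓ
  DualEquation A B = ∀ y → natF F ∣ B ∣ * absSq G F (chr y) A ≈ natF F (∣ A ∣ ℕ.* ∣ A ∣ ℕ.* ν G B y)

  TrivialOn : Elt G → Subset order → Set ℓ
  TrivialOn y H = ∀ h → h ∈ H → χ (chr y) h ≈ 1#

  chr-e-trivial : ∀ g → χ (chr e) g ≈ 1#
  chr-e-trivial g = x*x≈x⇒x≈1 (trans (sym (chr-hom e e g)) (reflexive (≡.cong (λ z → χ (chr z) g) (identity e))))
                              (χ-nonzero (chr e) g)

  ν-e≡∣A∣ : ∀ {A B} → DualEquation B A → 0 < ∣ B ∣ → ν G A e ≡ ∣ A ∣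
  ν-e≡∣A∣ {A} {B} dual 0<∣B∣ = ≡.sym (square-cancelˡ ∣ B ∣ 0<∣B∣ (≡.trans (ℕ.*-comm (∣ B ∣ ℕ.* ∣ B ∣) ∣ A ∣) (natF-injective charZero (begin
    natF F (∣ A ∣ ℕ.* (∣ B ∣ ℕ.* ∣ B ∣))          ≈⟨ natF-* ∣ A ∣ _ ⟩
    natF F ∣ A ∣ * natF F (∣ B ∣ ℕ.* ∣ B ∣)       ≈⟨ *-congˡ (absSq-trivial (chr e) B chr-e-trivial) ⟨
    natF F ∣ A ∣ * absSq G F (chr e) B            ≈⟨ dual e ⟩
    natF F (∣ B ∣ ℕ.* ∣ B ∣ ℕ.* ν G A e)          ∎))))

  twoValued-count : ∀ {A H a b} → TwoValued A H a b → a ℕ.* ∣ H ∣ ℕ.+ b ℕ.* ∣ ∁ H ∣ ≡ ∣ A ∣ ℕ.* ∣ A ∣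
  twoValued-count {A} {H} {a} {b} levels = natF-injective charZero (begin
    natF F (a ℕ.* ∣ H ∣ ℕ.+ b ℕ.* ∣ ∁ H ∣)                   ≈⟨ trans (natF-+ (a ℕ.* ∣ H ∣) _) (+-cong (natF-* a ∣ H ∣) (natF-* b ∣ ∁ H ∣)) ⟩
    natF F a * natF F ∣ H ∣ + natF F b * natF F ∣ ∁ H ∣       ≈⟨ +-cong (*-congˡ (count H)) (*-congˡ (count (∁ H))) ⟨
    natF F a * charSum G F (chr e) H + natF F b * charSum G F (chr e) (∁ H) ≈⟨ absSq-twoValued (chr e) levels ⟨
    absSq G F (chr e) A                                       ≈⟨ absSq-trivial (chr e) A chr-e-trivial ⟩
    natF F (∣ A ∣ ℕ.* ∣ A ∣)                                  ∎)
    where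
    count = λ X → charSum-trivialOn (chr e) X (λ g _ → chr-e-trivial g)

  ν-vanishes : ∀ {A B H a b y h} → DualEquation A B → 0 < ∣ A ∣ → TwoValued A H a b →
               IsSubgroup G H → h ∈ H → ¬ (χ (chr y) h ≈ 1#) → ν G B y ≡ 0
  ν-vanishes {A} {B} {H} {a} {b} {y} dual 0<∣A∣ levels H≤G h∈H χh≉1 =
    square-cancelˡ ∣ A ∣ 0<∣A∣ (≡.trans (natF-injective charZero (begin
      natF F (∣ A ∣ ℕ.* ∣ A ∣ ℕ.* ν G B y)                  ≈⟨ dual y ⟨
      natF F ∣ B ∣ * absSq G F (chr y) A                    ≈⟨ *-congˡ (absSq-twoValued (chr y) levels) ⟩
      natF F ∣ B ∣ * (natF F a * ψH + natF F b * ψH∁)       ≈⟨ *-congˡ (+-cong (*-congˡ ψH≈0) (*-congˡ ψH∁≈0)) ⟩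
      natF F ∣ B ∣ * (natF F a * 0# + natF F b * 0#)        ≈⟨ *-congˡ (trans (+-cong (zeroʳ _) (zeroʳ _)) (+-identityʳ 0#)) ⟩
      natF F ∣ B ∣ * 0#                                     ≈⟨ zeroʳ _ ⟩
      0#                                                    ∎)) (≡.sym (ℕ.*-zeroʳ (∣ A ∣ ℕ.* ∣ A ∣))))
    where
    ψH  = charSum G F (chr y) H
    ψH∁ = charSum G F (chr y) (∁ H)
    ψH≈0 : ψH ≈ 0#
    ψH≈0 = charSum-subgroup≈0 (chr y) H≤G h∈H χh≉1
    ψH∁≈0 : ψH∁ ≈ 0#
    ψH∁≈0 = begin
      ψH∁         ≈⟨ +-identityˡ ψH∁ ⟨
      0# + ψH∁    ≈⟨ +-congʳ ψH≈0 ⟨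
      ψH + ψH∁    ≈⟨ charSum+charSum-∁ (chr y) H ⟩
      sum (χ (chr y)) ≈⟨ sum-χ≈0 (chr y) χh≉1 ⟩
      0#          ∎

  -- |χ_y(A)|² = (a − b)·|H|, with both sides moved so that no subtraction occurs.
  ν-trivialOn : ∀ {A B H a b y g} → DualEquation A B → TwoValued A H a b → TrivialOn y H →
                ¬ (χ (chr y) g ≈ 1#) →
                ∣ B ∣ ℕ.* (a ℕ.* ∣ H ∣) ≡ ∣ A ∣ ℕ.* ∣ A ∣ ℕ.* ν G B y ℕ.+ ∣ B ∣ ℕ.* (b ℕ.* ∣ H ∣)
  ν-trivialOn {A} {B} {H} {a} {b} {y} dual levels trivial χg≉1 = natF-injective charZero (begin
    natF F (∣ B ∣ ℕ.* (a ℕ.* ∣ H ∣))                  ≈⟨ trans (natF-* ∣ B ∣ (a ℕ.* ∣ H ∣)) (*-congˡ (natF-* a ∣ H ∣)) ⟩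
    β * (natF F a * natF F ∣ H ∣)                     ≈⟨ *-congˡ (*-congˡ ψH≈∣H∣) ⟨
    β * (natF F a * ψH)                               ≈⟨ *-congˡ ([αx+βy]+βx≈αx (natF F a) (natF F b) ψH+ψH∁≈0) ⟨
    β * ((natF F a * ψH + natF F b * ψH∁) + natF F b * ψH)
                                                      ≈⟨ *-congˡ (+-congʳ (absSq-twoValued (chr y) levels)) ⟨
    β * (absSq G F (chr y) A + natF F b * ψH)         ≈⟨ distribˡ β _ _ ⟩
    β * absSq G F (chr y) A + β * (natF F b * ψH)     ≈⟨ +-cong (dual y) (*-congˡ (*-congˡ ψH≈∣H∣)) ⟩
    natF F (∣ A ∣ ℕ.* ∣ A ∣ ℕ.* ν G B y) + β * (natF F b * natF F ∣ H ∣)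
                                                      ≈⟨ +-congˡ (trans (natF-* ∣ B ∣ (b ℕ.* ∣ H ∣)) (*-congˡ (natF-* b ∣ H ∣))) ⟨
    natF F (∣ A ∣ ℕ.* ∣ A ∣ ℕ.* ν G B y) + natF F (∣ B ∣ ℕ.* (b ℕ.* ∣ H ∣))
                                                      ≈⟨ natF-+ (∣ A ∣ ℕ.* ∣ A ∣ ℕ.* ν G B y) _ ⟨
    natF F (∣ A ∣ ℕ.* ∣ A ∣ ℕ.* ν G B y ℕ.+ ∣ B ∣ ℕ.* (b ℕ.* ∣ H ∣)) ∎)
    where
    β   = natF F ∣ B ∣
    ψH  = charSum G F (chr y) H
    ψH∁ = charSum G F (chr y) (∁ H)
    ψH≈∣H∣ : ψH ≈ natF F ∣ H ∣
    ψH≈∣H∣ = charSum-trivialOn (chr y) H trivial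
    ψH+ψH∁≈0 : ψH + ψH∁ ≈ 0#
    ψH+ψH∁≈0 = trans (charSum+charSum-∁ (chr y) H) (sum-χ≈0 (chr y) χg≉1)

  annihilator-closed : ∀ {H y z} → TrivialOn y H → TrivialOn z H → TrivialOn (y ∙ z) H
  annihilator-closed {y = y} {z} trivialʸ trivialᶻ h h∈H =
    trans (chr-hom y z h) (trans (*-cong (trivialʸ h h∈H) (trivialᶻ h h∈H)) (*-identityʳ 1#))

  annihilator-inv : ∀ {H y} → TrivialOn y H → TrivialOn (inv y) H
  annihilator-inv {y = y} trivial h h∈H = begin
    χ (chr (inv y)) h                     ≈⟨ *-identityʳ _ ⟨
    χ (chr (inv y)) h * 1#                ≈⟨ *-congˡ (trivial h h∈H) ⟨
    χ (chr (inv y)) h * χ (chr y) h       ≈⟨ chr-hom (inv y) y h ⟨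
    χ (chr (inv y ∙ y)) h                 ≈⟨ reflexive (≡.cong (λ z → χ (chr z) h) (inverse y)) ⟩
    χ (chr e) h                           ≈⟨ chr-e-trivial h ⟩
    1#                                    ∎

  module _ (≈1? : ∀ y g → Dec (χ (chr y) g ≈ 1#)) where

    nontrivial : ∀ {y} → y ≢ e → ∃ λ g → ¬ (χ (chr y) g ≈ 1#)
    nontrivial {y} y≢e = Fin.¬∀⟶∃¬ _ _ (≈1? y)
      (λ trivial → y≢e (injective y e (λ g → trans (trivial g) (sym (chr-e-trivial g)))))

    trivialOn? : ∀ H y → Dec (TrivialOn y H)
    trivialOn? H y = Fin.all? (λ h → h ∈? H →-dec ≈1? y h)

    trivialOn-or-witness : ∀ H y → TrivialOn y H ⊎ (∃ λ h → h ∈ H × ¬ (χ (chr y) h ≈ 1#))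
    trivialOn-or-witness H y with Fin.any? (λ h → h ∈? H ×-dec ¬? (≈1? y h))
    ... | yes witness = inj₂ witness
    ... | no ¬witness = inj₁ λ h h∈H → decidable-stable (≈1? y h) (λ χh≉1 → ¬witness (h , h∈H , χh≉1))

    annihilator : Subset order → Subset order
    annihilator H = fromDec (trivialOn? H)

    annihilator-isSubgroup : ∀ H → IsSubgroup G (annihilator H)
    annihilator-isSubgroup H =
        ∈-fromDec⁺ (trivialOn? H) (λ h _ → chr-e-trivial h)
      , (λ y z y∈ z∈ → ∈-fromDec⁺ (trivialOn? H) (annihilator-closed (∈-fromDec⁻ (trivialOn? H) y∈) (∈-fromDec⁻ (trivialOn? H) z∈)))
      , (λ y y∈ → ∈-fromDec⁺ (trivialOn? H) (annihilator-inv (∈-fromDec⁻ (trivialOn? H) y∈)))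

    -- By ν-vanishes the differences of B lie in the annihilator of H, hence B in one of its cosets.
    all-trivialOn : ∀ {A B H a b} → Primitive G B → DualEquation A B → 0 < ∣ A ∣ → 0 < ∣ B ∣ →
                    TwoValued A H a b → IsSubgroup G H → ∀ y → TrivialOn y H
    all-trivialOn {A} {B} {H} primB dual 0<∣A∣ 0<∣B∣ levels H≤G y =
      ∈-fromDec⁻ (trivialOn? H) (InCoset⇒total primB (annihilator-isSubgroup H) (ν-support⇒InCoset t∈B support) y)
      where
      t∈B = proj₂ (0<∣p∣⇒Nonempty B 0<∣B∣)
      support : ∀ y → 0 < ν G B y → y ∈ annihilator H
      support y 0<ν with trivialOn-or-witness H y
      ... | inj₁ trivial            = ∈-fromDec⁺ (trivialOn? H) trivial
      ... | inj₂ (h , h∈H , χh≉1) = contradiction (ν-vanishes {B = B} dual 0<∣A∣ levels H≤G h∈H χh≉1) (ℕ.>⇒≢ 0<ν)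

    ν-constantOff-e : ∀ {A B H a b} → DualEquation A B → 0 < ∣ A ∣ → TwoValued A H a b →
                      (∀ y → TrivialOn y H) → ∀ {y z} → y ≢ e → z ≢ e → ν G B y ≡ ν G B z
    ν-constantOff-e {A} {B} {H} {a} {b} dual 0<∣A∣ levels trivial {y} {z} y≢e z≢e =
      square-cancelˡ ∣ A ∣ 0<∣A∣ (ℕ.+-cancelʳ-≡ (∣ B ∣ ℕ.* (b ℕ.* ∣ H ∣)) _ _
        (≡.trans (≡.sym (equationAt y≢e)) (equationAt z≢e)))
      where
      equationAt : ∀ {y} → y ≢ e → ∣ B ∣ ℕ.* (a ℕ.* ∣ H ∣) ≡ ∣ A ∣ ℕ.* ∣ A ∣ ℕ.* ν G B y ℕ.+ ∣ B ∣ ℕ.* (b ℕ.* ∣ H ∣)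
      equationAt {y} y≢e = ν-trivialOn {B = B} dual levels (trivial y) (proj₂ (nontrivial y≢e))

    ⁅e⁆-trivialOn : ∀ y → TrivialOn y ⁅ e ⁆
    ⁅e⁆-trivialOn y h h∈⁅e⁆ = trans (reflexive (≡.cong (χ (chr y)) (x∈⁅y⁆⇒x≡y e h∈⁅e⁆))) (unit (chr y))

    -- w = |G| − 1; the equations come from the dual equations at the trivial character and at χ_{g₀}.
    offIdentity-level≡0 : ∀ {S T m μ g₀} → DualEquation S T → 0 < ∣ S ∣ → 0 < ∣ T ∣ → g₀ ≢ e →
                          TwoValued S ⁅ e ⁆ ∣ S ∣ m → TwoValued T ⁅ e ⁆ ∣ T ∣ μ → m ≡ 0 ⊎ μ ≡ 0
    offIdentity-level≡0 {S} {T} {m} {μ} {g₀} dual 0<∣S∣ 0<∣T∣ g₀≢e levelsS levelsT =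
      one-level≡0 0<∣S∣ 0<∣T∣ 0<w (count levelsS) (count levelsT) cross
      where
      w = ∣ ∁ ⁅ e ⁆ ∣
      0<w : 0 < w
      0<w = ℕ.≤-trans (ℕ.≤-reflexive (≡.sym (∣⁅x⁆∣≡1 g₀)))
                      (p⊆q⇒∣p∣≤∣q∣ (λ x∈⁅g₀⁆ → x∉p⇒x∈∁p (x≢y⇒x∉⁅y⁆ (g₀≢e ∘ ≡.trans (≡.sym (x∈⁅y⁆⇒x≡y g₀ x∈⁅g₀⁆))))))
      ×∣⁅e⁆∣ : ∀ a → a ℕ.* ∣ ⁅ e ⁆ ∣ ≡ a
      ×∣⁅e⁆∣ a = ≡.trans (≡.cong (a ℕ.*_) (∣⁅x⁆∣≡1 e)) (ℕ.*-identityʳ a)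
      count : ∀ {A b} → TwoValued A ⁅ e ⁆ ∣ A ∣ b → ∣ A ∣ ℕ.+ b ℕ.* w ≡ ∣ A ∣ ℕ.* ∣ A ∣
      count {A} {b} levels = ≡.trans (≡.cong (ℕ._+ b ℕ.* w) (≡.sym (×∣⁅e⁆∣ ∣ A ∣))) (twoValued-count levels)
      cross : ∣ T ∣ ℕ.* ∣ S ∣ ≡ ∣ S ∣ ℕ.* ∣ S ∣ ℕ.* μ ℕ.+ ∣ T ∣ ℕ.* m
      cross = ≡.trans (≡.cong (∣ T ∣ ℕ.*_) (≡.sym (×∣⁅e⁆∣ ∣ S ∣))) (≡.trans
        (ν-trivialOn {B = T} dual levelsS (⁅e⁆-trivialOn g₀) (proj₂ (nontrivial g₀≢e)))
        (≡.cong₂ (λ k l → ∣ S ∣ ℕ.* ∣ S ∣ ℕ.* k ℕ.+ ∣ T ∣ ℕ.* l)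
                 (TwoValued.outside levelsT (x≢y⇒x∉⁅y⁆ g₀≢e)) (×∣⁅e⁆∣ m)))

    no-rankTwo : ∀ {S T} → Primitive G S → Primitive G T → FormallyDual G F Δ S T → EvenOfRank G S 2 → ⊥
    no-rankTwo {S} {T} primS primT (0<∣S∣ , 0<∣T∣ , dualST , dualTS) rank2 =
      [ primitive⇒level≢0 primS 0<∣S∣ g₀≢e levelsS , primitive⇒level≢0 primT 0<∣T∣ g₀≢e levelsT ]
        (offIdentity-level≡0 dualST 0<∣S∣ 0<∣T∣ g₀≢e levelsS levelsT)
      where
      open ProperTwoValued (rankTwo⇒ProperTwoValued primS 0<∣S∣ rank2)
      g₀≢e : g₀ ≢ e
      g₀≢e g₀≡e = g₀∉H (≡.subst (_∈ H) (≡.sym g₀≡e) (Subgroup.e∈H H≤G))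
      levelsT : TwoValued T ⁅ e ⁆ ∣ T ∣ (ν G T g₀)
      levelsT = constantOff-e⇒TwoValued (ν-e≡∣A∣ {T} {S} dualST 0<∣S∣)
        (ν-constantOff-e {B = T} dualST 0<∣S∣ twoValued (all-trivialOn primT dualST 0<∣S∣ 0<∣T∣ twoValued H≤G)) g₀≢e
      levelsS : TwoValued S ⁅ e ⁆ ∣ S ∣ (ν G S g₀)
      levelsS = constantOff-e⇒TwoValued (ν-e≡∣A∣ {S} {T} dualTS 0<∣T∣)
        (ν-constantOff-e {B = S} dualTS 0<∣T∣ levelsT ⁅e⁆-trivialOn) g₀≢e

-- Equality in F need not be decidable, but the goal is negative, so we may decide
-- χ_y(g) ≈ 1 for the finitely many pairs (y, g).
theorem4p17 : ∀ {c ℓ} (F : Field c ℓ) → CharZero F → (G : FinAbGroup)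
    → (S : Subset (FinAbGroup.order G))
    → ¬ (PrimitiveFormallyDualSet G F S × EvenOfRank G S 2)
theorem4p17 F charZero G S ((Δ , T , primS , primT , dual) , rank2) =
  ¬¬-∀-Fin _ (λ y → ¬¬-∀-Fin _ (λ g → ¬¬-excluded-middle)) λ ≈1? →
    FormalDuality.no-rankTwo F charZero G Δ ≈1? primS primT dual rank2
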